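{- (i) The path $P_n$ on $n$ vertices is well-indumatched if and only if $n\in\{1,2,3,4,7\}$. (ii) The cycle $C_n$ on $n\geq 3$ vertices is well-indumatched if and only if $n\in\{3,4,5,6,7,8,11\}$.
   Context: All graphs are finite, simple and undirected. An induced matching of a graph $G$ is a set $M$ of edges, no two sharing an endpoint, such that no edge of $G$ joins an endpoint of one edge of $M$ to an endpoint of another edge of $M$. A graph is well-indumatched if all of its inclusion-wise maximal induced matchings have the same size. -}

module Defs where

open import Data.Nat using (ℕ; zero; suc; _≤_; s≤s; z≤n)
open import Data.Nat.Properties using (1+n≢n)
import Data.Empty
open import Data.Empty using (⊥-elim)
open import Data.Sum using (inj₁; inj₂)
open import Relation.Binary.PropositionalEquality using (refl; sym; trans; cong)
open import Data.Fin using (Fin; toℕ)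
open import Data.Product using (_×_; _,_; Σ)
open import Data.Sum using (_⊎_)
open import Data.List using (List; length)
open import Data.List.Membership.Propositional using (_∈_)
open import Data.List.Relation.Unary.All using (All)
open import Relation.Nullary using (¬_)
open import Relation.Binary.PropositionalEquality using (_≡_)

record Graph (n : ℕ) : Set₁ where
  field
    Adj   : Fin n → Fin n → Set
    adj-sym : ∀ {u v} → Adj u v → Adj v u
    irrefl : ∀ {u} → ¬ Adj u u
open Graph public

PathAdj : (n : ℕ) → Fin n → Fin n → Set
PathAdj n i j = (toℕ j ≡ suc (toℕ i)) ⊎ (toℕ i ≡ suc (toℕ j))

CycleAdj : (n : ℕ) → Fin n → Fin n → Set
CycleAdj n i j =
  PathAdj n i j
  ⊎ ((toℕ i ≡ 0 × suc (toℕ j) ≡ n) ⊎ (toℕ j ≡ 0 × suc (toℕ i) ≡ n))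

PathAdj-sym : ∀ {n} {i j : Fin n} → PathAdj n i j → PathAdj n j i
PathAdj-sym (inj₁ p) = inj₂ p
PathAdj-sym (inj₂ p) = inj₁ p

PathAdj-irrefl : ∀ {n} {i : Fin n} → ¬ PathAdj n i i
PathAdj-irrefl (inj₁ p) = 1+n≢n (sym p)
PathAdj-irrefl (inj₂ p) = 1+n≢n (sym p)

Path : (n : ℕ) → Graph n
Path n = record { Adj = PathAdj n ; adj-sym = PathAdj-sym ; irrefl = PathAdj-irrefl }

CycleAdj-sym : ∀ {n} {i j : Fin n} → CycleAdj n i j → CycleAdj n j i
CycleAdj-sym (inj₁ p) = inj₁ (PathAdj-sym p)
CycleAdj-sym (inj₂ (inj₁ p)) = inj₂ (inj₂ p)
CycleAdj-sym (inj₂ (inj₂ p)) = inj₂ (inj₁ p)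

private
  bad : ∀ {n} → 3 ≤ n → ∀ {k} → k ≡ 0 → suc k ≡ n → Data.Empty.⊥
  bad (s≤s (s≤s (s≤s _))) refl ()

CycleAdj-irrefl : ∀ {n} → 3 ≤ n → {i : Fin n} → ¬ CycleAdj n i i
CycleAdj-irrefl h (inj₁ p) = PathAdj-irrefl p
CycleAdj-irrefl h (inj₂ (inj₁ (p , q))) = bad h p q
CycleAdj-irrefl h (inj₂ (inj₂ (p , q))) = bad h p q

Cycle : (n : ℕ) → 3 ≤ n → Graph n
Cycle n h = record { Adj = CycleAdj n ; adj-sym = CycleAdj-sym ; irrefl = CycleAdj-irrefl h }

Edge : ℕ → Set
Edge n = Fin n × Fin n

SameEdge : ∀ {n} → Edge n → Edge n → Set
SameEdge (a , b) (c , d) = (a ≡ c × b ≡ d) ⊎ (a ≡ d × b ≡ c)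

ShareEndpoint : ∀ {n} → Edge n → Edge n → Set
ShareEndpoint (a , b) (c , d) = (a ≡ c ⊎ a ≡ d) ⊎ (b ≡ c ⊎ b ≡ d)

Joined : ∀ {n} → Graph n → Edge n → Edge n → Set
Joined G (a , b) (c , d) = (Adj G a c ⊎ Adj G a d) ⊎ (Adj G b c ⊎ Adj G b d)

_∈E_ : ∀ {n} → Edge n → List (Edge n) → Set
e ∈E M = Σ (Edge _) λ f → f ∈ M × SameEdge e f

-- An induced matching: a list of edges of G such that any two entries at
-- distinct positions neither share an endpoint nor are joined by an edge of G.
-- (This forces the entries to be pairwise distinct edges, so the size of the
-- matching is the length of the list.)
record IsInducedMatching {n} (G : Graph n) (M : List (Edge n)) : Set where
  field
    edges    : All (λ e → Adj G (Data.Product.proj₁ e) (Data.Product.proj₂ e)) M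
    disjoint : ∀ (i j : Fin (length M)) → ¬ i ≡ j →
               ¬ ShareEndpoint (Data.List.lookup M i) (Data.List.lookup M j)
    induced  : ∀ (i j : Fin (length M)) → ¬ i ≡ j →
               ¬ Joined G (Data.List.lookup M i) (Data.List.lookup M j)

record IsMaximalInducedMatching {n} (G : Graph n) (M : List (Edge n)) : Set where
  field
    isIM    : IsInducedMatching G M
    maximal : ∀ (M' : List (Edge n)) → IsInducedMatching G M' →
              (∀ e → e ∈E M → e ∈E M') → (∀ e → e ∈E M' → e ∈E M)

WellIndumatched : ∀ {n} → Graph n → Set
WellIndumatched {n} G =
  ∀ (M M' : List (Edge n)) →
  IsMaximalInducedMatching G M → IsMaximalInducedMatching G M' →
  length M ≡ length M'

-- Number the edges of P_n and C_n consecutively.  Two edges conflict (cannot lie together in an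
-- induced matching) exactly when some endpoint of one equals or is adjacent to some endpoint of the
-- other, which for a path means that their indices differ by at most 2.  Maximal induced matchings
-- therefore correspond to independent dominating sets of edge indices for this conflict relation.
--
-- For the listed n an exhaustive search shows that every independent set of indices extends to one
-- of a fixed size k, and that no fewer than k indices dominate; so all maximal induced matchings
-- have size k.  For the other n we exhibit two independent dominating sets of different sizes.  On
-- paths, small cases are found by search, and adding the last edge to both sets turns a pair for
-- P_{m+1} into one for P_{m+4}.  On C_{m+5}, the edge {0,1} together with a pair for the path on the
-- vertices 3, ..., m+3 gives a pair for the cycle.

module Submission where

open import Defs
open import Data.Nat using (ℕ; zero; suc; _+_; _≤_; s≤s; z≤n; s≤s⁻¹; _<?_)
import Data.Nat.Properties as ℕ
open import Data.Nat.Properties using (≤-antisym)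
open import Data.Fin using (Fin; zero; suc; toℕ; inject₁; inject≤; fromℕ; fromℕ<; lower₁; #_)
import Data.Fin.Properties as Fin
open import Data.Product using (_×_; _,_; Σ; proj₁; proj₂)
open import Data.Sum using (_⊎_; inj₁; inj₂)
import Data.Sum as Sum
open import Data.Empty using (⊥-elim)
open import Data.Unit using (⊤; tt)
open import Data.List using (List; []; _∷_; length; map; lookup)
open import Data.List.Properties using (length-map)
open import Data.List.Membership.Propositional using (_∈_; find; lose)
open import Data.List.Membership.Propositional.Properties using (∈-lookup)
open import Data.List.Relation.Unary.All as All using (All; []; _∷_)
open import Data.List.Relation.Unary.All.Properties using (¬Any⇒All¬; All¬⇒¬Any) renaming (map⁺ to All-map⁺)
open import Data.List.Relation.Unary.Any as Any using (Any; here; there)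
import Data.List.Relation.Unary.Any.Properties as Any
open import Data.List.Relation.Unary.AllPairs as AllPairs using (AllPairs; []; _∷_)
import Data.List.Relation.Unary.AllPairs.Properties as AllPairs
open import Function using (_∘_; id)
open import Function.Bundles using (_⇔_; mk⇔; Equivalence)
open import Relation.Nullary using (¬_; Dec; yes; no; contradiction)
open import Relation.Nullary.Decidable
  using (True; False; toWitness; toWitnessFalse; _⊎-dec_; _×-dec_; _→-dec_; ¬?; decidable-stable)
open import Relation.Binary.Definitions using (tri<; tri≈; tri>)
open import Relation.Binary.PropositionalEquality
  using (_≡_; refl; sym; trans; cong; subst; subst₂; module ≡-Reasoning)

Linked : {A : Set} → (A → A → Set) → A × A → A × A → Set
Linked R (a , b) (c , d) = (R a c ⊎ R a d) ⊎ (R b c ⊎ R b d)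

module _ {A : Set} {R : A → A → Set} where

  linked-sym : (∀ {u v} → R u v → R v u) → ∀ {e f} → Linked R e f → Linked R f e
  linked-sym sym (inj₁ (inj₁ r)) = inj₁ (inj₁ (sym r))
  linked-sym sym (inj₁ (inj₂ r)) = inj₂ (inj₁ (sym r))
  linked-sym sym (inj₂ (inj₁ r)) = inj₁ (inj₂ (sym r))
  linked-sym sym (inj₂ (inj₂ r)) = inj₂ (inj₂ (sym r))

  linked? : (∀ u v → Dec (R u v)) → ∀ e f → Dec (Linked R e f)
  linked? R? (a , b) (c , d) = (R? a c ⊎-dec R? a d) ⊎-dec (R? b c ⊎-dec R? b d)

linked-map-vertices : {A B C : Set} {R : A → A → Set} {S : B → B → Set} (f : C → A) (g : C → B) →
                      (∀ {u v} → R (f u) (f v) → S (g u) (g v)) →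
                      ∀ {a b c d} → Linked R (f a , f b) (f c , f d) → Linked S (g a , g b) (g c , g d)
linked-map-vertices f g h (inj₁ (inj₁ r)) = inj₁ (inj₁ (h r))
linked-map-vertices f g h (inj₁ (inj₂ r)) = inj₁ (inj₂ (h r))
linked-map-vertices f g h (inj₂ (inj₁ r)) = inj₂ (inj₁ (h r))
linked-map-vertices f g h (inj₂ (inj₂ r)) = inj₂ (inj₂ (h r))

linked-map : {A : Set} {R S : A → A → Set} → (∀ {u v} → R u v → S u v) →
             ∀ {e f} → Linked R e f → Linked S e f
linked-map {R = R} {S} h {a , b} {c , d} = linked-map-vertices {R = R} {S = S} id id h

linked-split : {A : Set} {R S : A → A → Set} → ∀ {e f} →
               Linked (λ u v → R u v ⊎ S u v) e f → Linked R e f ⊎ Linked S e f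
linked-split (inj₁ (inj₁ (inj₁ r))) = inj₁ (inj₁ (inj₁ r))
linked-split (inj₁ (inj₁ (inj₂ s))) = inj₂ (inj₁ (inj₁ s))
linked-split (inj₁ (inj₂ (inj₁ r))) = inj₁ (inj₁ (inj₂ r))
linked-split (inj₁ (inj₂ (inj₂ s))) = inj₂ (inj₁ (inj₂ s))
linked-split (inj₂ (inj₁ (inj₁ r))) = inj₁ (inj₂ (inj₁ r))
linked-split (inj₂ (inj₁ (inj₂ s))) = inj₂ (inj₂ (inj₁ s))
linked-split (inj₂ (inj₂ (inj₁ r))) = inj₁ (inj₂ (inj₂ r))
linked-split (inj₂ (inj₂ (inj₂ s))) = inj₂ (inj₂ (inj₂ s))

linked-respects-same : ∀ {n} {R : Fin n → Fin n → Set} {e e′ f : Edge n} →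
                       SameEdge e e′ → Linked R e f → Linked R e′ f
linked-respects-same (inj₁ (refl , refl)) l = l
linked-respects-same (inj₂ (refl , refl)) l = Sum.swap l

same-edge-sym : ∀ {n} {e f : Edge n} → SameEdge e f → SameEdge f e
same-edge-sym (inj₁ (refl , refl)) = inj₁ (refl , refl)
same-edge-sym (inj₂ (refl , refl)) = inj₂ (refl , refl)

same-edge-trans : ∀ {n} {e f g : Edge n} → SameEdge e f → SameEdge f g → SameEdge e g
same-edge-trans (inj₁ (refl , refl)) s = s
same-edge-trans (inj₂ (refl , refl)) (inj₁ (refl , refl)) = inj₂ (refl , refl)
same-edge-trans (inj₂ (refl , refl)) (inj₂ (refl , refl)) = inj₁ (refl , refl)

all-of-lookup : {A : Set} {P : A → Set} {xs : List A} → (∀ i → P (lookup xs i)) → All P xs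
all-of-lookup {xs = []} p = []
all-of-lookup {xs = x ∷ xs} p = p zero ∷ all-of-lookup (p ∘ suc)

module _ {A : Set} {R : A → A → Set} where

  allPairs-of-lookup : {xs : List A} → (∀ i j → ¬ i ≡ j → R (lookup xs i) (lookup xs j)) → AllPairs R xs
  allPairs-of-lookup {[]} r = []
  allPairs-of-lookup {x ∷ xs} r =
    all-of-lookup (λ j → r zero (suc j) λ ()) ∷
    allPairs-of-lookup (λ i j i≢j → r (suc i) (suc j) (i≢j ∘ Fin.suc-injective))

  module _ (sym : ∀ {u v} → R u v → R v u) where

    lookup-of-allPairs : {xs : List A} → AllPairs R xs → ∀ i j → ¬ i ≡ j → R (lookup xs i) (lookup xs j)
    lookup-of-allPairs (r ∷ rs) zero zero i≢j = contradiction refl i≢j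
    lookup-of-allPairs (r ∷ rs) zero (suc j) _ = All.lookup r (∈-lookup j)
    lookup-of-allPairs (r ∷ rs) (suc i) zero _ = sym (All.lookup r (∈-lookup i))
    lookup-of-allPairs (r ∷ rs) (suc i) (suc j) i≢j = lookup-of-allPairs rs i j (i≢j ∘ cong suc)

    allPairs¬-member-≡ : {xs : List A} → AllPairs (λ u v → ¬ R u v) xs →
                         ∀ {x y} → x ∈ xs → y ∈ xs → R x y → x ≡ y
    allPairs¬-member-≡ (r ∷ rs) (here refl) (here refl) _ = refl
    allPairs¬-member-≡ (r ∷ rs) (here refl) (there y∈) rxy = contradiction rxy (All.lookup r y∈)
    allPairs¬-member-≡ (r ∷ rs) (there x∈) (here refl) rxy = contradiction (sym rxy) (All.lookup r x∈)
    allPairs¬-member-≡ (r ∷ rs) (there x∈) (there y∈) rxy = allPairs¬-member-≡ rs x∈ y∈ rxy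

Touch : ∀ {n} → Graph n → Fin n → Fin n → Set
Touch G u v = u ≡ v ⊎ Adj G u v

Conflict : ∀ {n} → Graph n → Edge n → Edge n → Set
Conflict G = Linked (Touch G)

module _ {n : ℕ} (G : Graph n) where

  IsEdge : Edge n → Set
  IsEdge e = Adj G (proj₁ e) (proj₂ e)

  touch-sym : ∀ {u v} → Touch G u v → Touch G v u
  touch-sym (inj₁ refl) = inj₁ refl
  touch-sym (inj₂ a) = inj₂ (adj-sym G a)

  conflict-sym : ∀ {e f} → Conflict G e f → Conflict G f e
  conflict-sym = linked-sym {R = Touch G} touch-sym

  conflict-respects-same : ∀ {e e′ f f′} → SameEdge e e′ → SameEdge f f′ →
                           Conflict G e f → Conflict G e′ f′
  conflict-respects-same e~e′ f~f′ =
    conflict-sym ∘ linked-respects-same {R = Touch G} f~f′ ∘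
    conflict-sym ∘ linked-respects-same {R = Touch G} e~e′

  same-edge⇒conflict : ∀ {e f} → SameEdge e f → Conflict G e f
  same-edge⇒conflict (inj₁ (refl , refl)) = inj₁ (inj₁ (inj₁ refl))
  same-edge⇒conflict (inj₂ (refl , refl)) = inj₁ (inj₂ (inj₁ refl))

  share⇒conflict : ∀ {e f} → ShareEndpoint e f → Conflict G e f
  share⇒conflict = linked-map {R = _≡_} {S = Touch G} inj₁

  joined⇒conflict : ∀ {e f} → Joined G e f → Conflict G e f
  joined⇒conflict = linked-map {R = Adj G} {S = Touch G} inj₂

  conflict⇒share⊎joined : ∀ {e f} → Conflict G e f → ShareEndpoint e f ⊎ Joined G e f
  conflict⇒share⊎joined = linked-split {R = _≡_} {S = Adj G}

  conflict? : (∀ u v → Dec (Adj G u v)) → ∀ e f → Dec (Conflict G e f)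
  conflict? adj? = linked? (λ u v → u Fin.≟ v ⊎-dec adj? u v)

  Pairwise-nonconflicting : List (Edge n) → Set
  Pairwise-nonconflicting = AllPairs (λ e f → ¬ Conflict G e f)

  induced⇒pairwise-nonconflicting : ∀ {M} → IsInducedMatching G M → Pairwise-nonconflicting M
  induced⇒pairwise-nonconflicting im = allPairs-of-lookup λ i j i≢j c →
    Sum.[ IsInducedMatching.disjoint im i j i≢j , IsInducedMatching.induced im i j i≢j ]
      (conflict⇒share⊎joined c)

  pairwise-nonconflicting⇒induced : ∀ {M} → All IsEdge M → Pairwise-nonconflicting M → IsInducedMatching G M
  pairwise-nonconflicting⇒induced edges pw = record
    { edges    = edges
    ; disjoint = λ i j i≢j → nonconflicting i j i≢j ∘ share⇒conflict
    ; induced  = λ i j i≢j → nonconflicting i j i≢j ∘ joined⇒conflict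
    }
    where nonconflicting = lookup-of-allPairs (λ ¬c → ¬c ∘ conflict-sym) pw

  Dominates : List (Edge n) → Set
  Dominates M = ∀ {a b} → Adj G a b → Any (Conflict G (a , b)) M

  dominating⇒maximal : ∀ {M} → IsInducedMatching G M → Dominates M → IsMaximalInducedMatching G M
  dominating⇒maximal {M} im dom = record { isIM = im ; maximal = maximal }
    where
    maximal : ∀ M′ → IsInducedMatching G M′ → (∀ e → e ∈E M → e ∈E M′) → ∀ e → e ∈E M′ → e ∈E M
    maximal M′ im′ M⊆M′ e (f , f∈M′ , e~f)
      with find (dom (All.lookup (IsInducedMatching.edges im′) f∈M′))
    ... | g , g∈M , f-g with M⊆M′ g (g , g∈M , inj₁ (refl , refl))
    ... | g′ , g′∈M′ , g~g′ with allPairs¬-member-≡ conflict-sym (induced⇒pairwise-nonconflicting im′)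
                                   f∈M′ g′∈M′ (conflict-respects-same (inj₁ (refl , refl)) g~g′ f-g)
    ... | refl = g , g∈M , same-edge-trans e~f (same-edge-sym g~g′)

  maximal⇒¬¬dominates : ∀ {M} → IsMaximalInducedMatching G M → ∀ {a b} → Adj G a b →
                        ¬ ¬ Any (Conflict G (a , b)) M
  maximal⇒¬¬dominates {M} mx {a} {b} ab ¬dom with
    IsMaximalInducedMatching.maximal mx ((a , b) ∷ M) extended (λ _ (f , f∈ , s) → f , there f∈ , s)
      (a , b) ((a , b) , here refl , inj₁ (refl , refl))
    where
    im = IsMaximalInducedMatching.isIM mx
    extended : IsInducedMatching G ((a , b) ∷ M)
    extended = pairwise-nonconflicting⇒induced (ab ∷ IsInducedMatching.edges im)
                 (¬Any⇒All¬ M ¬dom ∷ induced⇒pairwise-nonconflicting im)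
  ... | f , f∈M , ab~f = ¬dom (lose f∈M (same-edge⇒conflict ab~f))

record EdgeEnumeration {n : ℕ} (G : Graph n) : Set where
  field
    size       : ℕ
    edge       : Fin size → Edge n
    edge-adj   : ∀ i → IsEdge G (edge i)
    edge-cover : ∀ {a b} → Adj G a b → Σ (Fin size) λ i → SameEdge (a , b) (edge i)

module Enumerated {n : ℕ} {G : Graph n} (adj? : ∀ u v → Dec (Adj G u v)) (E : EdgeEnumeration G) where
  open EdgeEnumeration E

  Clash : Fin size → Fin size → Set
  Clash i j = Conflict G (edge i) (edge j)

  clash? : ∀ i j → Dec (Clash i j)
  clash? i j = conflict? G adj? (edge i) (edge j)

  Apart : Fin size → Fin size → Set
  Apart i j = ¬ Clash i j

  Independent : List (Fin size) → Set
  Independent = AllPairs Apart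

  independent? : ∀ S → Dec (Independent S)
  independent? = AllPairs.allPairs? λ i j → ¬? (clash? i j)

  Dominating : List (Fin size) → Set
  Dominating S = ∀ j → Any (Clash j) S

  dominating? : ∀ S → Dec (Dominating S)
  dominating? S = Fin.all? λ j → Any.any? (clash? j) S

  MaximalIndependent : List (Fin size) → Set
  MaximalIndependent S = Independent S × Dominating S

  maximalIndependent? : ∀ S → Dec (MaximalIndependent S)
  maximalIndependent? S = independent? S ×-dec dominating? S

  edges-maximal : ∀ {S} → MaximalIndependent S → IsMaximalInducedMatching G (map edge S)
  edges-maximal {S} (ind , dom) = dominating⇒maximal G
    (pairwise-nonconflicting⇒induced G (All-map⁺ (All.universal edge-adj S)) (AllPairs.map⁺ ind))
    λ ab → let i , ab~i = edge-cover ab in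
      Any.map⁺ (Any.map (conflict-respects-same G (same-edge-sym ab~i) (inj₁ (refl , refl))) (dom i))

  label : ∀ {e} → IsEdge G e → Fin size
  label ab = proj₁ (edge-cover ab)

  same-as-label : ∀ {e} (ab : IsEdge G e) → SameEdge e (edge (label ab))
  same-as-label ab = proj₂ (edge-cover ab)

  labels : ∀ {M} → All (IsEdge G) M → List (Fin size)
  labels [] = []
  labels (ab ∷ abs) = label ab ∷ labels abs

  length-labels : ∀ {M} (abs : All (IsEdge G) M) → length (labels abs) ≡ length M
  length-labels [] = refl
  length-labels (ab ∷ abs) = cong suc (length-labels abs)

  labels-apart : ∀ {e M} (ab : IsEdge G e) (abs : All (IsEdge G) M) →
                 All (λ f → ¬ Conflict G e f) M → All (Apart (label ab)) (labels abs)
  labels-apart ab [] [] = []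
  labels-apart ab (cd ∷ abs) (¬c ∷ ¬cs) =
    (¬c ∘ conflict-respects-same G (same-edge-sym (same-as-label ab)) (same-edge-sym (same-as-label cd)))
    ∷ labels-apart ab abs ¬cs

  labels-independent : ∀ {M} (abs : All (IsEdge G) M) → Pairwise-nonconflicting G M →
                       Independent (labels abs)
  labels-independent [] [] = []
  labels-independent (ab ∷ abs) (¬cs ∷ pw) = labels-apart ab abs ¬cs ∷ labels-independent abs pw

  labels-clash : ∀ {M} (abs : All (IsEdge G) M) {j} → Any (Conflict G (edge j)) M → Any (Clash j) (labels abs)
  labels-clash (cd ∷ abs) (here c) = here (conflict-respects-same G (inj₁ (refl , refl)) (same-as-label cd) c)
  labels-clash (cd ∷ abs) (there c) = there (labels-clash abs c)

  labels-dominating : ∀ {M} (abs : All (IsEdge G) M) → Dominates G M → Dominating (labels abs)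
  labels-dominating abs dom j = labels-clash abs (dom (edge-adj j))

  -- Both bounds grow the list of chosen indices one index at a time, so that for a concrete graph
  -- they are decided by a search that stops as soon as an index clashes.
  IndependentExtensions≤ : ℕ → List (Fin size) → Set
  IndependentExtensions≤ zero S = Dominating S
  IndependentExtensions≤ (suc k) S = ∀ i → All (Apart i) S → IndependentExtensions≤ k (i ∷ S)

  DominatingExtensions≥ : ℕ → List (Fin size) → Set
  DominatingExtensions≥ zero S = ⊤
  DominatingExtensions≥ (suc k) S = ¬ Dominating S × (∀ i → DominatingExtensions≥ k (i ∷ S))

  independentExtensions≤? : ∀ k S → Dec (IndependentExtensions≤ k S)
  independentExtensions≤? zero S = dominating? S
  independentExtensions≤? (suc k) S =
    Fin.all? λ i → All.all? (λ j → ¬? (clash? i j)) S →-dec independentExtensions≤? k (i ∷ S)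

  dominatingExtensions≥? : ∀ k S → Dec (DominatingExtensions≥ k S)
  dominatingExtensions≥? zero S = yes tt
  dominatingExtensions≥? (suc k) S = ¬? (dominating? S) ×-dec Fin.all? λ i → dominatingExtensions≥? k (i ∷ S)

  independent-extension-length≤ : ∀ k S {L} → IndependentExtensions≤ k S → Independent L →
                                  All (λ i → All (Apart i) S) L → length L ≤ k
  independent-extension-length≤ k S {[]} _ _ _ = z≤n
  independent-extension-length≤ zero S {i ∷ L} dom _ (i-S ∷ _) = contradiction (dom i) (All¬⇒¬Any i-S)
  independent-extension-length≤ (suc k) S {i ∷ L} ext (i-L ∷ ind) (i-S ∷ L-S) =
    s≤s (independent-extension-length≤ k (i ∷ S) (ext i i-S) ind
          (All.zipWith (λ (j-i , j-S) → (j-i ∘ conflict-sym G) ∷ j-S) (i-L , L-S)))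

  dominating-extension-length≥ : ∀ k S {L} → DominatingExtensions≥ k S →
                                 (∀ j → Any (Clash j) S ⊎ Any (Clash j) L) → k ≤ length L
  dominating-extension-length≥ zero S _ _ = z≤n
  dominating-extension-length≥ (suc k) S {[]} (¬dom , _) dom =
    contradiction (λ j → Sum.[ id , (λ ()) ] (dom j)) ¬dom
  dominating-extension-length≥ (suc k) S {i ∷ L} (_ , ext) dom =
    s≤s (dominating-extension-length≥ k (i ∷ S) (ext i) (λ j → move (dom j)))
    where
    move : ∀ {j} → Any (Clash j) S ⊎ Any (Clash j) (i ∷ L) → Any (Clash j) (i ∷ S) ⊎ Any (Clash j) L
    move (inj₁ c) = inj₁ (there c)
    move (inj₂ (here c)) = inj₁ (here c)
    move (inj₂ (there c)) = inj₂ c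

  maximal-matching-size : ∀ k → IndependentExtensions≤ k [] → DominatingExtensions≥ k [] →
                          ∀ {M} → IsMaximalInducedMatching G M → length M ≡ k
  maximal-matching-size k ext≤ ext≥ {M} mx = ≤-antisym
    (subst (_≤ k) (length-labels abs)
      (independent-extension-length≤ k [] ext≤ (labels-independent abs (induced⇒pairwise-nonconflicting G im))
        (All.universal (λ _ → []) _)))
    (subst (k ≤_) (length-labels abs)
      (dominating-extension-length≥ k [] ext≥ (inj₂ ∘ labels-dominating abs dom)))
    where
    im = IsMaximalInducedMatching.isIM mx
    abs = IsInducedMatching.edges im
    -- Maximality alone only excludes undominated edges; decidability of conflict makes this positive.
    dom : Dominates G M
    dom ab = decidable-stable (Any.any? (conflict? G adj? _) M) (maximal⇒¬¬dominates G mx ab)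

  well-indumatched-of-bounds : ∀ k → IndependentExtensions≤ k [] → DominatingExtensions≥ k [] →
                               WellIndumatched G
  well-indumatched-of-bounds k ext≤ ext≥ M M′ mx mx′ =
    trans (maximal-matching-size k ext≤ ext≥ mx) (sym (maximal-matching-size k ext≤ ext≥ mx′))

  well-indumatched-by-computation : ∀ k →
    {True (independentExtensions≤? k [] ×-dec dominatingExtensions≥? k [])} → WellIndumatched G
  well-indumatched-by-computation k {bounds} =
    let ext≤ , ext≥ = toWitness bounds in well-indumatched-of-bounds k ext≤ ext≥

  record UnequalMaximalIndependentSets : Set where
    field
      first second   : List (Fin size)
      first-maximal  : MaximalIndependent first
      second-maximal : MaximalIndependent second
      sizes-differ   : ¬ length first ≡ length second

  unequal-by-computation : ∀ S T → {True (maximalIndependent? S)} → {True (maximalIndependent? T)} →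
                           {False (length S ℕ.≟ length T)} → UnequalMaximalIndependentSets
  unequal-by-computation S T {S-max} {T-max} {S≢T} = record
    { first = S ; second = T ; first-maximal = toWitness S-max ; second-maximal = toWitness T-max
    ; sizes-differ = toWitnessFalse S≢T }

  not-well-indumatched : UnequalMaximalIndependentSets → ¬ WellIndumatched G
  not-well-indumatched u wi = sizes-differ (begin
    length first             ≡⟨ length-map edge first ⟨
    length (map edge first)  ≡⟨ wi _ _ (edges-maximal first-maximal) (edges-maximal second-maximal) ⟩
    length (map edge second) ≡⟨ length-map edge second ⟩
    length second            ∎)
    where open UnequalMaximalIndependentSets u
          open ≡-Reasoning

  well-indumatched⇔ : {Q : Set} → (Q → WellIndumatched G) → Q ⊎ UnequalMaximalIndependentSets →
                      WellIndumatched G ⇔ Q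
  well-indumatched⇔ sufficient q⊎u =
    mk⇔ (λ wi → Sum.[ id , (λ u → contradiction wi (not-well-indumatched u)) ] q⊎u) sufficient

Within : ℕ → ℕ → ℕ → Set
Within d x y = x ≤ d + y × y ≤ d + x

within-suc⁻ : ∀ {d x y} → Within d (suc x) (suc y) → Within d x y
within-suc⁻ {d} {x} {y} (p , q) =
  s≤s⁻¹ (subst (suc x ≤_) (ℕ.+-suc d y) p) , s≤s⁻¹ (subst (suc y ≤_) (ℕ.+-suc d x) q)

within-suc : ∀ {d x y} → Within d x y → Within d (suc x) (suc y)
within-suc {d} {x} {y} (p , q) =
  subst (suc x ≤_) (sym (ℕ.+-suc d y)) (s≤s p) , subst (suc y ≤_) (sym (ℕ.+-suc d x)) (s≤s q)

within-+ : ∀ {d x y} k → Within d (k + x) (k + y) ⇔ Within d x y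
within-+ zero = mk⇔ id id
within-+ (suc k) = mk⇔ (Equivalence.to (within-+ k) ∘ within-suc⁻) (within-suc ∘ Equivalence.from (within-+ k))

consecutive-within⇔ : ∀ {x y} → Linked (Within 1) (x , suc x) (y , suc y) ⇔ Within 2 x y
consecutive-within⇔ {x} {y} = mk⇔ to from
  where
  to : Linked (Within 1) (x , suc x) (y , suc y) → Within 2 x y
  to (inj₁ (inj₁ (p , q))) = ℕ.m≤n⇒m≤1+n p , ℕ.m≤n⇒m≤1+n q
  to (inj₁ (inj₂ (p , q))) = p , ℕ.m≤n⇒m≤1+n (ℕ.≤-trans (ℕ.n≤1+n y) q)
  to (inj₂ (inj₁ (p , q))) = ℕ.m≤n⇒m≤1+n (ℕ.≤-trans (ℕ.n≤1+n x) p) , q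
  to (inj₂ (inj₂ (p , q))) = ℕ.m≤n⇒m≤1+n (s≤s⁻¹ p) , ℕ.m≤n⇒m≤1+n (s≤s⁻¹ q)
  from : Within 2 x y → Linked (Within 1) (x , suc x) (y , suc y)
  from (p , q) with ℕ.≤-total x y
  ... | inj₁ x≤y = inj₂ (inj₁ (s≤s x≤y , q))
  ... | inj₂ y≤x = inj₁ (inj₂ (p , s≤s y≤x))

toℕ⇒≡inject₁ : ∀ {m} {a : Fin (suc m)} {i : Fin m} → toℕ a ≡ toℕ i → a ≡ inject₁ i
toℕ⇒≡inject₁ {i = i} a≡i = Fin.toℕ-injective (trans a≡i (sym (Fin.toℕ-inject₁ i)))

toℕ⇒≡fromℕ : ∀ {m} {a : Fin (suc m)} → toℕ a ≡ m → a ≡ fromℕ m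
toℕ⇒≡fromℕ {m} a≡m = Fin.toℕ-injective (trans a≡m (sym (Fin.toℕ-fromℕ m)))

path-adj? : ∀ {n} (u v : Fin n) → Dec (PathAdj n u v)
path-adj? u v = (toℕ v ℕ.≟ suc (toℕ u)) ⊎-dec (toℕ u ℕ.≟ suc (toℕ v))

path-touch⇔within : ∀ {n} {u v : Fin n} → Touch (Path n) u v ⇔ Within 1 (toℕ u) (toℕ v)
path-touch⇔within {n} {u} {v} = mk⇔ to from
  where
  to : Touch (Path n) u v → Within 1 (toℕ u) (toℕ v)
  to (inj₁ refl) = ℕ.n≤1+n _ , ℕ.n≤1+n _
  to (inj₂ (inj₁ v≡1+u)) rewrite v≡1+u = ℕ.m≤n⇒m≤1+n (ℕ.n≤1+n _) , ℕ.≤-refl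
  to (inj₂ (inj₂ u≡1+v)) rewrite u≡1+v = ℕ.≤-refl , ℕ.m≤n⇒m≤1+n (ℕ.n≤1+n _)
  from : Within 1 (toℕ u) (toℕ v) → Touch (Path n) u v
  from (p , q) with ℕ.<-cmp (toℕ u) (toℕ v)
  ... | tri< u<v _ _ = inj₂ (inj₁ (≤-antisym q u<v))
  ... | tri≈ _ u≡v _ = inj₁ (Fin.toℕ-injective u≡v)
  ... | tri> _ _ v<u = inj₂ (inj₂ (≤-antisym p v<u))

pathEdge : ∀ {m} → Fin m → Edge (suc m)
pathEdge i = inject₁ i , suc i

pathEdge-adj : ∀ {m} (i : Fin m) → PathAdj (suc m) (inject₁ i) (suc i)
pathEdge-adj i = inj₁ (cong suc (sym (Fin.toℕ-inject₁ i)))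

pathEdge-cover : ∀ {m} {a b : Fin (suc m)} → PathAdj (suc m) a b →
                 Σ (Fin m) λ i → SameEdge (a , b) (pathEdge i)
pathEdge-cover {b = suc i} (inj₁ 1+i≡1+a) = i , inj₁ (toℕ⇒≡inject₁ (sym (ℕ.suc-injective 1+i≡1+a)) , refl)
pathEdge-cover {a = suc i} (inj₂ 1+i≡1+b) = i , inj₂ (refl , toℕ⇒≡inject₁ (sym (ℕ.suc-injective 1+i≡1+b)))

pathEnumeration : ∀ m → EdgeEnumeration (Path (suc m))
pathEnumeration m = record
  { size = m ; edge = pathEdge ; edge-adj = pathEdge-adj ; edge-cover = pathEdge-cover }

module PathMatchings (m : ℕ) = Enumerated (path-adj? {suc m}) (pathEnumeration m)

pathEdge-conflict⇔within : ∀ {m} {i j : Fin m} →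
                           Conflict (Path (suc m)) (pathEdge i) (pathEdge j) ⇔ Within 2 (toℕ i) (toℕ j)
pathEdge-conflict⇔within {m} {i} {j} = mk⇔
  (Equivalence.to consecutive-within⇔ ∘ subst₂ ends (Fin.toℕ-inject₁ i) (Fin.toℕ-inject₁ j) ∘
     linked-map-vertices {R = Touch (Path (suc m))} {S = Within 1} id toℕ (Equivalence.to path-touch⇔within))
  (linked-map-vertices {R = Within 1} {S = Touch (Path (suc m))} toℕ id (Equivalence.from path-touch⇔within) ∘
     subst₂ ends (sym (Fin.toℕ-inject₁ i)) (sym (Fin.toℕ-inject₁ j)) ∘ Equivalence.from consecutive-within⇔)
  where
  ends : ℕ → ℕ → Set
  ends x y = Linked (Within 1) (x , suc (toℕ i)) (y , suc (toℕ j))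

path-clash-translate : ∀ {m m′} {i j : Fin m} {i′ j′ : Fin m′} k →
                       toℕ i′ ≡ k + toℕ i → toℕ j′ ≡ k + toℕ j →
                       PathMatchings.Clash m′ i′ j′ ⇔ PathMatchings.Clash m i j
path-clash-translate k i′≡k+i j′≡k+j = mk⇔
  (Equivalence.from pathEdge-conflict⇔within ∘ Equivalence.to (within-+ k) ∘
     subst₂ (Within 2) i′≡k+i j′≡k+j ∘ Equivalence.to pathEdge-conflict⇔within)
  (Equivalence.from pathEdge-conflict⇔within ∘ subst₂ (Within 2) (sym i′≡k+i) (sym j′≡k+j) ∘
     Equivalence.from (within-+ k) ∘ Equivalence.to pathEdge-conflict⇔within)

module _ {m : ℕ} where
  open PathMatchings

  inject₃ : Fin m → Fin (3 + m)
  inject₃ i = inject≤ i (ℕ.m≤n+m m 3)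

  extend : List (Fin m) → List (Fin (3 + m))
  extend S = fromℕ (2 + m) ∷ map inject₃ S

  inject₃-apart : ∀ {i j} → Apart m i j → Apart (3 + m) (inject₃ i) (inject₃ j)
  inject₃-apart ¬c = ¬c ∘ Equivalence.to (path-clash-translate 0 (Fin.toℕ-inject≤ _ _) (Fin.toℕ-inject≤ _ _))

  last-apart-inject₃ : ∀ i → Apart (3 + m) (fromℕ (2 + m)) (inject₃ i)
  last-apart-inject₃ i c with Equivalence.to pathEdge-conflict⇔within c
  ... | 2+m≤2+i , _ rewrite Fin.toℕ-fromℕ (2 + m) | Fin.toℕ-inject≤ i (ℕ.m≤n+m m 3) =
    ℕ.<⇒≱ (Fin.toℕ<n i) (ℕ.+-cancelˡ-≤ 2 m (toℕ i) 2+m≤2+i)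

  extend-independent : ∀ {S} → Independent m S → Independent (3 + m) (extend S)
  extend-independent {S} ind =
    All-map⁺ (All.universal last-apart-inject₃ S) ∷ AllPairs.map⁺ (AllPairs.map inject₃-apart ind)

  extend-dominating : ∀ {S} → Dominating m S → Dominating (3 + m) (extend S)
  extend-dominating {S} dom j with toℕ j <? m
  ... | yes j<m = there (Any.map⁺ (Any.map
          (Equivalence.from (path-clash-translate 0 (sym (Fin.toℕ-fromℕ< j<m)) (Fin.toℕ-inject≤ _ _)))
          (dom (fromℕ< j<m))))
  ... | no j≮m = here (Equivalence.from pathEdge-conflict⇔within (j≤4+m , 2+m≤2+j))
    where
    j≤4+m : toℕ j ≤ 2 + toℕ (fromℕ (2 + m))
    j≤4+m rewrite Fin.toℕ-fromℕ (2 + m) = ℕ.m≤n⇒m≤o+n 2 (s≤s⁻¹ (Fin.toℕ<n j))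
    2+m≤2+j : toℕ (fromℕ (2 + m)) ≤ 2 + toℕ j
    2+m≤2+j rewrite Fin.toℕ-fromℕ (2 + m) = ℕ.+-monoʳ-≤ 2 (ℕ.≮⇒≥ j≮m)

  extend-maximal : ∀ {S} → MaximalIndependent m S → MaximalIndependent (3 + m) (extend S)
  extend-maximal (ind , dom) = extend-independent ind , extend-dominating dom

  extend-unequal : UnequalMaximalIndependentSets m → UnequalMaximalIndependentSets (3 + m)
  extend-unequal u = record
    { first = extend first ; second = extend second
    ; first-maximal = extend-maximal first-maximal ; second-maximal = extend-maximal second-maximal
    ; sizes-differ = λ eq → sizes-differ
        (trans (sym (length-map inject₃ first)) (trans (ℕ.suc-injective eq) (length-map inject₃ second)))
    }
    where open UnequalMaximalIndependentSets m u

path-unequal-4 : PathMatchings.UnequalMaximalIndependentSets 4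
path-unequal-4 = PathMatchings.unequal-by-computation 4 (# 1 ∷ []) (# 0 ∷ # 3 ∷ [])

path-unequal-5 : PathMatchings.UnequalMaximalIndependentSets 5
path-unequal-5 = PathMatchings.unequal-by-computation 5 (# 2 ∷ []) (# 0 ∷ # 3 ∷ [])

path-unequal-7+ : ∀ k → PathMatchings.UnequalMaximalIndependentSets (7 + k)
path-unequal-7+ 0 = PathMatchings.unequal-by-computation 7 (# 2 ∷ # 6 ∷ []) (# 0 ∷ # 3 ∷ # 6 ∷ [])
path-unequal-7+ 1 = extend-unequal path-unequal-5
path-unequal-7+ 2 = PathMatchings.unequal-by-computation 9 (# 2 ∷ # 7 ∷ []) (# 0 ∷ # 3 ∷ # 6 ∷ [])
path-unequal-7+ (suc (suc (suc k))) = extend-unequal (path-unequal-7+ k)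

path-well-indumatched : ∀ {m} → suc m ∈ (1 ∷ 2 ∷ 3 ∷ 4 ∷ 7 ∷ []) → WellIndumatched (Path (suc m))
path-well-indumatched (here refl) = PathMatchings.well-indumatched-by-computation 0 0
path-well-indumatched (there (here refl)) = PathMatchings.well-indumatched-by-computation 1 1
path-well-indumatched (there (there (here refl))) = PathMatchings.well-indumatched-by-computation 2 1
path-well-indumatched (there (there (there (here refl)))) = PathMatchings.well-indumatched-by-computation 3 1
path-well-indumatched (there (there (there (there (here refl))))) =
  PathMatchings.well-indumatched-by-computation 6 2

path-dichotomy : ∀ m → suc m ∈ (1 ∷ 2 ∷ 3 ∷ 4 ∷ 7 ∷ []) ⊎ PathMatchings.UnequalMaximalIndependentSets m
path-dichotomy 0 = inj₁ (here refl)
path-dichotomy 1 = inj₁ (there (here refl))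
path-dichotomy 2 = inj₁ (there (there (here refl)))
path-dichotomy 3 = inj₁ (there (there (there (here refl))))
path-dichotomy 4 = inj₂ path-unequal-4
path-dichotomy 5 = inj₂ path-unequal-5
path-dichotomy 6 = inj₁ (there (there (there (there (here refl)))))
path-dichotomy (suc (suc (suc (suc (suc (suc (suc k))))))) = inj₂ (path-unequal-7+ k)

path-classification : ∀ m → WellIndumatched (Path (suc m)) ⇔ suc m ∈ (1 ∷ 2 ∷ 3 ∷ 4 ∷ 7 ∷ [])
path-classification m = PathMatchings.well-indumatched⇔ m path-well-indumatched (path-dichotomy m)

WrapAdj : (n : ℕ) → Fin n → Fin n → Set
WrapAdj n u v = (toℕ u ≡ 0 × suc (toℕ v) ≡ n) ⊎ (toℕ v ≡ 0 × suc (toℕ u) ≡ n)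

cycle-adj? : ∀ {n} (u v : Fin n) → Dec (CycleAdj n u v)
cycle-adj? {n} u v =
  path-adj? u v ⊎-dec
  ((toℕ u ℕ.≟ 0 ×-dec suc (toℕ v) ℕ.≟ n) ⊎-dec (toℕ v ℕ.≟ 0 ×-dec suc (toℕ u) ℕ.≟ n))

cycleEdge : ∀ {m} → Fin (suc m) → Edge (suc m)
cycleEdge {m} zero = zero , fromℕ m
cycleEdge (suc i) = pathEdge i

cycleEdge-adj : ∀ {m} (i : Fin (suc m)) → CycleAdj (suc m) (proj₁ (cycleEdge i)) (proj₂ (cycleEdge i))
cycleEdge-adj {m} zero = inj₂ (inj₁ (refl , cong suc (Fin.toℕ-fromℕ m)))
cycleEdge-adj (suc i) = inj₁ (pathEdge-adj i)

cycleEdge-cover : ∀ {m} {a b : Fin (suc m)} → CycleAdj (suc m) a b →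
                  Σ (Fin (suc m)) λ i → SameEdge (a , b) (cycleEdge i)
cycleEdge-cover (inj₁ ab) = let i , ab~i = pathEdge-cover ab in suc i , ab~i
cycleEdge-cover (inj₂ (inj₁ (a≡0 , 1+b≡1+m))) =
  zero , inj₁ (Fin.toℕ-injective a≡0 , toℕ⇒≡fromℕ (ℕ.suc-injective 1+b≡1+m))
cycleEdge-cover (inj₂ (inj₂ (b≡0 , 1+a≡1+m))) =
  zero , inj₂ (toℕ⇒≡fromℕ (ℕ.suc-injective 1+a≡1+m) , Fin.toℕ-injective b≡0)

cycleEnumeration : ∀ m (h : 3 ≤ suc m) → EdgeEnumeration (Cycle (suc m) h)
cycleEnumeration m h = record
  { size = suc m ; edge = cycleEdge ; edge-adj = cycleEdge-adj ; edge-cover = cycleEdge-cover }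

module CycleMatchings (m : ℕ) (h : 3 ≤ suc m) = Enumerated (cycle-adj? {suc m}) (cycleEnumeration m h)

path⇒cycle-conflict : ∀ {n h e f} → Conflict (Path n) e f → Conflict (Cycle n h) e f
path⇒cycle-conflict {n} {h} = linked-map {R = Touch (Path n)} {S = Touch (Cycle n h)} (Sum.map₂ inj₁)

cycle-conflict-split : ∀ {n h e f} → Conflict (Cycle n h) e f → Conflict (Path n) e f ⊎ Linked (WrapAdj n) e f
cycle-conflict-split {n} {h} =
  linked-split {R = Touch (Path n)} {S = WrapAdj n} ∘ linked-map {R = Touch (Cycle n h)} Sum.assocˡ

wrap-needs-origin : ∀ {n} {a b c d : Fin n} → ¬ Linked (WrapAdj (suc n)) (suc a , suc b) (suc c , suc d)
wrap-needs-origin (inj₁ (inj₁ (inj₁ (() , _))))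
wrap-needs-origin (inj₁ (inj₁ (inj₂ (() , _))))
wrap-needs-origin (inj₁ (inj₂ (inj₁ (() , _))))
wrap-needs-origin (inj₁ (inj₂ (inj₂ (() , _))))
wrap-needs-origin (inj₂ (inj₁ (inj₁ (() , _))))
wrap-needs-origin (inj₂ (inj₁ (inj₂ (() , _))))
wrap-needs-origin (inj₂ (inj₂ (inj₁ (() , _))))
wrap-needs-origin (inj₂ (inj₂ (inj₂ (() , _))))

module _ {m : ℕ} (h : 3 ≤ 5 + m) where
  private
    module P = PathMatchings m
    module C = CycleMatchings (4 + m) h

  -- The cycle index of the edge {x + 3, x + 4}.
  shift : Fin m → Fin (5 + m)
  shift x = suc (suc (suc (suc (inject₁ x))))

  wrap : List (Fin m) → List (Fin (5 + m))
  wrap S = suc zero ∷ map shift S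

  shift-clash⇔ : ∀ {x y} → C.Clash (shift x) (shift y) ⇔ P.Clash x y
  shift-clash⇔ {x} {y} = mk⇔
    (λ c → Equivalence.to translate (Sum.[ id , ⊥-elim ∘ wrap-needs-origin ] (cycle-conflict-split {h = h} c)))
    (λ c → path⇒cycle-conflict {h = h} (Equivalence.from translate c))
    where
    translate : PathMatchings.Clash (4 + m) (suc (suc (suc (inject₁ x)))) (suc (suc (suc (inject₁ y)))) ⇔
                P.Clash x y
    translate = path-clash-translate 3 (cong (3 +_) (Fin.toℕ-inject₁ x)) (cong (3 +_) (Fin.toℕ-inject₁ y))

  origin-apart-shift : ∀ x → C.Apart (suc zero) (shift x)
  origin-apart-shift x = Sum.[ not-path-close , not-wrap ] ∘ cycle-conflict-split {h = h}
    where
    not-path-close : ¬ Conflict (Path (5 + m)) (pathEdge zero) (pathEdge (suc (suc (suc (inject₁ x)))))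
    not-path-close c with Equivalence.to pathEdge-conflict⇔within c
    ... | _ , s≤s (s≤s ())
    not-wrap : ¬ Linked (WrapAdj (5 + m)) (pathEdge zero) (pathEdge (suc (suc (suc (inject₁ x)))))
    not-wrap (inj₁ (inj₁ (inj₁ (_ , 4+x≡5+m)))) =
      Fin.toℕ-inject₁-≢ (inject₁ x) (sym (ℕ.+-cancelˡ-≡ 4 _ _ 4+x≡5+m))
    not-wrap (inj₁ (inj₂ (inj₁ (_ , 5+x≡5+m)))) =
      Fin.toℕ-inject₁-≢ x (sym (ℕ.+-cancelˡ-≡ 5 _ _ 5+x≡5+m))
    not-wrap (inj₁ (inj₁ (inj₂ (() , _))))
    not-wrap (inj₁ (inj₂ (inj₂ (() , _))))
    not-wrap (inj₂ (inj₁ (inj₁ (() , _))))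
    not-wrap (inj₂ (inj₁ (inj₂ (() , _))))
    not-wrap (inj₂ (inj₂ (inj₁ (() , _))))
    not-wrap (inj₂ (inj₂ (inj₂ (() , _))))

  wrap-independent : ∀ {S} → P.Independent S → C.Independent (wrap S)
  wrap-independent {S} ind =
    All-map⁺ (All.universal origin-apart-shift S) ∷
    AllPairs.map⁺ (AllPairs.map (λ ¬c → ¬c ∘ Equivalence.to shift-clash⇔) ind)

  wrap-dominating : ∀ {S} → P.Dominating S → C.Dominating (wrap S)
  wrap-dominating dom zero = here (inj₁ (inj₁ (inj₁ refl)))
  wrap-dominating dom (suc zero) = here (inj₁ (inj₁ (inj₁ refl)))
  wrap-dominating dom (suc (suc zero)) = here (inj₁ (inj₂ (inj₁ refl)))
  wrap-dominating dom (suc (suc (suc zero))) = here (inj₁ (inj₂ (inj₂ (inj₁ (inj₂ refl)))))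
  wrap-dominating {S} dom (suc (suc (suc (suc k)))) with m ℕ.≟ toℕ k
  ... | yes m≡k = here (inj₂ (inj₁ (inj₂ (inj₂ (inj₂ (refl , cong (5 +_) (sym m≡k)))))))
  ... | no m≢k = there (subst (λ i → Any (C.Clash (suc (suc (suc (suc i))))) (map shift S))
                           (Fin.inject₁-lower₁ k m≢k)
                           (Any.map⁺ (Any.map (Equivalence.from shift-clash⇔) (dom (lower₁ k m≢k)))))

  wrap-maximal : ∀ {S} → P.MaximalIndependent S → C.MaximalIndependent (wrap S)
  wrap-maximal (ind , dom) = wrap-independent ind , wrap-dominating dom

  wrap-unequal : P.UnequalMaximalIndependentSets → C.UnequalMaximalIndependentSets
  wrap-unequal u = record
    { first = wrap first ; second = wrap second
    ; first-maximal = wrap-maximal first-maximal ; second-maximal = wrap-maximal second-maximal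
    ; sizes-differ = λ eq → sizes-differ
        (trans (sym (length-map shift first)) (trans (ℕ.suc-injective eq) (length-map shift second)))
    }
    where open P.UnequalMaximalIndependentSets u

cycle-well-indumatched : ∀ {m} (h : 3 ≤ suc m) → suc m ∈ (3 ∷ 4 ∷ 5 ∷ 6 ∷ 7 ∷ 8 ∷ 11 ∷ []) →
                         WellIndumatched (Cycle (suc m) h)
cycle-well-indumatched h (here refl) = CycleMatchings.well-indumatched-by-computation 2 h 1
cycle-well-indumatched h (there (here refl)) = CycleMatchings.well-indumatched-by-computation 3 h 1
cycle-well-indumatched h (there (there (here refl))) = CycleMatchings.well-indumatched-by-computation 4 h 1
cycle-well-indumatched h (there (there (there (here refl)))) =
  CycleMatchings.well-indumatched-by-computation 5 h 2
cycle-well-indumatched h (there (there (there (there (here refl))))) =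
  CycleMatchings.well-indumatched-by-computation 6 h 2
cycle-well-indumatched h (there (there (there (there (there (here refl)))))) =
  CycleMatchings.well-indumatched-by-computation 7 h 2
cycle-well-indumatched h (there (there (there (there (there (there (here refl))))))) =
  CycleMatchings.well-indumatched-by-computation 10 h 3

cycle-dichotomy : ∀ m (h : 3 ≤ suc m) →
                  suc m ∈ (3 ∷ 4 ∷ 5 ∷ 6 ∷ 7 ∷ 8 ∷ 11 ∷ []) ⊎
                  CycleMatchings.UnequalMaximalIndependentSets m h
cycle-dichotomy 0 (s≤s ())
cycle-dichotomy 1 (s≤s (s≤s ()))
cycle-dichotomy 2 h = inj₁ (here refl)
cycle-dichotomy 3 h = inj₁ (there (here refl))
cycle-dichotomy 4 h = inj₁ (there (there (here refl)))
cycle-dichotomy 5 h = inj₁ (there (there (there (here refl))))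
cycle-dichotomy 6 h = inj₁ (there (there (there (there (here refl)))))
cycle-dichotomy 7 h = inj₁ (there (there (there (there (there (here refl))))))
cycle-dichotomy 8 h = inj₂ (wrap-unequal h path-unequal-4)
cycle-dichotomy 9 h = inj₂ (wrap-unequal h path-unequal-5)
cycle-dichotomy 10 h = inj₁ (there (there (there (there (there (there (here refl)))))))
cycle-dichotomy (suc (suc (suc (suc (suc (suc (suc (suc (suc (suc (suc k))))))))))) h =
  inj₂ (wrap-unequal h (path-unequal-7+ k))

cycle-classification : ∀ m (h : 3 ≤ suc m) →
                       WellIndumatched (Cycle (suc m) h) ⇔ suc m ∈ (3 ∷ 4 ∷ 5 ∷ 6 ∷ 7 ∷ 8 ∷ 11 ∷ [])
cycle-classification m h = CycleMatchings.well-indumatched⇔ m h (cycle-well-indumatched h) (cycle-dichotomy m h)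

lemma3p2 :
    (∀ (n : ℕ) → 1 ≤ n →
      (WellIndumatched (Path n) ⇔ n ∈ (1 ∷ 2 ∷ 3 ∷ 4 ∷ 7 ∷ [])))
    × (∀ (n : ℕ) → (h : 3 ≤ n) →
      (WellIndumatched (Cycle n h) ⇔ n ∈ (3 ∷ 4 ∷ 5 ∷ 6 ∷ 7 ∷ 8 ∷ 11 ∷ [])))
lemma3p2 = (λ { (suc m) _ → path-classification m }) , (λ { (suc m) h → cycle-classification m h })
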